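{- Let $k\ge1$ and let $G$ be a $k$-path with associated sequence $e_0,t_1,e_1,t_2,\dots,t_p,e_p$ of $k$-cliques $e_i$ and $(k+1)$-cliques $t_i$. Let $e$ be an edge joining the vertex of $t_r\setminus e_r$ and the vertex of $t_r\setminus e_{r-1}$ for some $1\le r\le p$ (that is, $e$ is an edge of one of the zero forcing chains induced by the forces "$t_i\setminus e_i$ forces $t_i\setminus e_{i-1}$"). Then the graph $G-e$ obtained by deleting the edge $e$ is not $k$-connected.
   Context: All graphs are simple and undirected. A $k$-path is a graph $G$ built together with a sequence $e_0,t_1,e_1,\dots,t_p,e_p$ ($p\ge1$) as follows: $t_1$ is a complete graph $K_{k+1}$ and $e_0,e_1$ are two distinct $k$-element subsets of $t_1$; for $i=2,\dots,p$ a new vertex $u_i$ is added adjacent exactly to the vertices of $e_{i-1}$, $t_i=e_{i-1}\cup\{u_i\}$, and $e_i$ is a $k$-element subset of $t_i$ different from $e_{i-1}$. Thus $t_i\setminus e_i$ and $t_i\setminus e_{i-1}$ are single vertices, which are adjacent. A graph is $k$-connected if its vertex connectivity is at least $k$, where the vertex connectivity of a connected non-complete graph is the minimum number of vertices whose removal disconnects it, and that of $K_n$ is $n-1$. -}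

module Defs where

open import Data.Nat using (ℕ; zero; suc; _≤_; _<_; _∸_)
open import Data.Fin using (Fin)
open import Data.Fin.Subset using (Subset; _∈_; _∉_; _⊆_; _∪_; ⁅_⁆; ∣_∣)
open import Data.Product using (Σ; ∃; _×_; _,_)
open import Data.Sum using (_⊎_)
open import Relation.Binary.PropositionalEquality using (_≡_; _≢_)
open import Relation.Nullary using (¬_)

Graph : ℕ → Set₁
Graph n = Fin n → Fin n → Set

-- A k-path on the vertex set Fin n, together with its sequence
-- e_0, t_1, e_1, ..., t_p, e_p (sequences indexed by ℕ; only indices
-- 0..p for e, 1..p for t and 2..p for the new vertices u matter).
record KPath (k n : ℕ) : Set where
  field
    p     : ℕ
    1≤p   : 1 ≤ p
    e     : ℕ → Subset n
    t     : ℕ → Subset n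
    u     : ℕ → Fin n
    t₁-size : ∣ t 1 ∣ ≡ suc k
    e₀⊆t₁   : e 0 ⊆ t 1
    e₁⊆t₁   : e 1 ⊆ t 1
    e₀-size : ∣ e 0 ∣ ≡ k
    e₁-size : ∣ e 1 ∣ ≡ k
    e₀≢e₁   : e 0 ≢ e 1
    u-new₁  : ∀ i → 2 ≤ i → i ≤ p → u i ∉ t 1
    u-new   : ∀ i j → 2 ≤ j → j < i → i ≤ p → u i ≢ u j
    t-step  : ∀ i → 2 ≤ i → i ≤ p → t i ≡ e (i ∸ 1) ∪ ⁅ u i ⁆
    e⊆t     : ∀ i → 2 ≤ i → i ≤ p → e i ⊆ t i
    e-size  : ∀ i → 2 ≤ i → i ≤ p → ∣ e i ∣ ≡ k
    e-new   : ∀ i → 2 ≤ i → i ≤ p → e i ≢ e (i ∸ 1)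
    cover   : ∀ x → x ∈ t 1 ⊎ (∃ λ i → 2 ≤ i × i ≤ p × x ≡ u i)

kpathGraph : ∀ {k n} → KPath k n → Graph n
kpathGraph P x y =
  x ≢ y ×
  ((x ∈ t 1 × y ∈ t 1) ⊎
   (∃ λ i → 2 ≤ i × i ≤ p ×
      ((x ≡ u i × y ∈ e (i ∸ 1)) ⊎ (y ≡ u i × x ∈ e (i ∸ 1)))))
  where open KPath P

deleteEdge : ∀ {n} → Graph n → Fin n → Fin n → Graph n
deleteEdge G a b x y =
  G x y × ¬ ((x ≡ a × y ≡ b) ⊎ (x ≡ b × y ≡ a))

data Reach {n} (G : Graph n) (S : Subset n) : Fin n → Fin n → Set where
  here : ∀ {x} → x ∉ S → Reach G S x x
  step : ∀ {x y z} → x ∉ S → G x y → Reach G S y z → Reach G S x z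

Disconnects : ∀ {n} → Graph n → Subset n → Set
Disconnects G S = ∃ λ x → ∃ λ y → x ∉ S × y ∉ S × ¬ Reach G S x y

Complete : ∀ {n} → Graph n → Set
Complete {n} G = ∀ (x y : Fin n) → x ≢ y → G x y

-- Vertex connectivity ≥ k: for K_n this means n - 1 ≥ k; otherwise
-- every disconnecting vertex set has size ≥ k (for a disconnected graph
-- the empty set disconnects, so the connectivity is 0).
KConnected : ∀ {n} → ℕ → Graph n → Set
KConnected {n} k G =
  (Complete G × k ≤ n ∸ 1) ⊎
  (¬ Complete G × (∀ S → Disconnects G S → k ≤ ∣ S ∣))

-- Put S = t_r ∖ {a, b}, a set of k − 1 vertices (t_r ∖ e_r = {a} and
-- t_r ∖ e_{r−1} = {b}, with a ≠ b because e_r ≠ e_{r−1}).  The vertices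
-- introduced before step r, together with a, are closed under the edges of
-- (G − ab) − S: an edge leaving them must go to some u_i with i ≥ r from a
-- vertex of e_{i−1}; for i = r that is the deleted edge ab, and for i > r the
-- vertex lies in e_r ∖ S = {b} or was itself introduced after step r.  Since
-- b = u_r (or b ∈ t_1 ∖ {a} when r = 1) is not among them, S separates a
-- from b in G − ab.
module Submission where

open import Defs
open import Data.Nat using (ℕ; zero; suc; _+_; _≤_; _<_; _∸_; z≤n; s≤s; _≤?_)
open import Data.Nat.Properties
  using (≤-refl; ≤-trans; ≤-reflexive; ≤-pred; ≤-antisym; <⇒≱; ≰⇒>; n≤1+n; m≤n⇒m≤1+n;
         m≤n⇒m<n∨m≡n; <-≤-trans; <-irrefl; <-asym; <-cmp; +-suc; +-comm; +-monoʳ-≤)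
open import Data.Fin using (Fin)
open import Data.Fin.Properties using () renaming (_≟_ to _≟ᶠ_)
open import Data.Fin.Subset using (Subset; _∈_; _∉_; _⊆_; _∪_; _─_; _-_; ⁅_⁆; ∣_∣; inside; outside)
open import Data.Fin.Subset.Properties
  using (_∈?_; ∣p∣≤∣x∷p∣; ∣⁅x⁆∣≡1; p⊂q⇒∣p∣<∣q∣; x∈p⇒∣p-x∣<∣p∣; x∈p∧x≢y⇒x∈p-y; p─q⊆p;
         x∈p∪q⁻; x∈p∪q⁺; x∈⁅x⁆; x∈⁅y⁆⇒x≡y; ⊆-antisym)
open import Data.Vec.Base using ([]; _∷_; here; there)
open import Data.Product using (∃; _×_; _,_)
open import Data.Sum using (_⊎_; inj₁; inj₂; [_,_]′)
open import Data.Empty using (⊥-elim)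
open import Relation.Binary using (tri<; tri≈; tri>)
open import Relation.Binary.PropositionalEquality using (_≡_; _≢_; refl; sym; trans; subst; cong₂)
open import Relation.Nullary using (¬_; yes; no)
open import Relation.Nullary.Negation using (contradiction)

∣p∪q∣≤∣p∣+∣q∣ : ∀ {n} (p q : Subset n) → ∣ p ∪ q ∣ ≤ ∣ p ∣ + ∣ q ∣
∣p∪q∣≤∣p∣+∣q∣ [] [] = z≤n
∣p∪q∣≤∣p∣+∣q∣ (inside ∷ p) (s ∷ q) =
  s≤s (≤-trans (∣p∪q∣≤∣p∣+∣q∣ p q) (+-monoʳ-≤ ∣ p ∣ (∣p∣≤∣x∷p∣ s q)))
∣p∪q∣≤∣p∣+∣q∣ (outside ∷ p) (inside ∷ q) =
  ≤-trans (s≤s (∣p∪q∣≤∣p∣+∣q∣ p q)) (≤-reflexive (sym (+-suc ∣ p ∣ ∣ q ∣)))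
∣p∪q∣≤∣p∣+∣q∣ (outside ∷ p) (outside ∷ q) = ∣p∪q∣≤∣p∣+∣q∣ p q

x∈p─q⇒x∉q : ∀ {n} {x : Fin n} (p q : Subset n) → x ∈ p ─ q → x ∉ q
x∈p─q⇒x∉q (_ ∷ p) (outside ∷ q) here ()
x∈p─q⇒x∉q (_ ∷ p) (inside ∷ q) () here
x∈p─q⇒x∉q (_ ∷ p) (_ ∷ q) (there x∈p─q) (there x∈q) = x∈p─q⇒x∉q p q x∈p─q x∈q

x∉p-x : ∀ {n} {x : Fin n} (p : Subset n) → x ∉ p - x
x∉p-x {x = x} p x∈p-x = x∈p─q⇒x∉q p ⁅ x ⁆ x∈p-x (x∈⁅x⁆ x)

x∉p∧p⊆q⇒p⊆q-x : ∀ {n} {x : Fin n} {p q : Subset n} → x ∉ p → p ⊆ q → p ⊆ q - x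
x∉p∧p⊆q⇒p⊆q-x x∉p p⊆q y∈p = x∈p∧x≢y⇒x∈p-y (p⊆q y∈p) (λ { refl → x∉p y∈p })

p⊆q∧∣q∣≤∣p∣⇒q⊆p : ∀ {n} {p q : Subset n} → p ⊆ q → ∣ q ∣ ≤ ∣ p ∣ → q ⊆ p
p⊆q∧∣q∣≤∣p∣⇒q⊆p {p = p} p⊆q ∣q∣≤∣p∣ {x} x∈q with x ∈? p
... | yes x∈p = x∈p
... | no x∉p = contradiction ∣q∣≤∣p∣ (<⇒≱ (p⊂q⇒∣p∣<∣q∣ (p⊆q , x , x∈q , x∉p)))

p⊆q-x∧∣q∣≤1+∣p∣⇒p≡q-x : ∀ {n} {x : Fin n} {p q : Subset n} →
                        x ∈ q → p ⊆ q - x → ∣ q ∣ ≤ suc ∣ p ∣ → p ≡ q - x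
p⊆q-x∧∣q∣≤1+∣p∣⇒p≡q-x x∈q p⊆q-x ∣q∣≤1+∣p∣ =
  ⊆-antisym p⊆q-x (p⊆q∧∣q∣≤∣p∣⇒q⊆p p⊆q-x (≤-pred (≤-trans (x∈p⇒∣p-x∣<∣p∣ x∈q) ∣q∣≤1+∣p∣)))

ClosedOutside : ∀ {n} → Graph n → Subset n → (Fin n → Set) → Set
ClosedOutside G S Q = ∀ {x y} → x ∉ S → y ∉ S → G x y → Q x → Q y

module _ {n : ℕ} {G : Graph n} {S : Subset n} where

  Reach-source∉ : ∀ {x z} → Reach G S x z → x ∉ S
  Reach-source∉ (here x∉S) = x∉S
  Reach-source∉ (step x∉S _ _) = x∉S

  Reach-preserves : ∀ {Q x z} → ClosedOutside G S Q → Reach G S x z → Q x → Q z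
  Reach-preserves closed (here _) Qx = Qx
  Reach-preserves closed (step x∉S xy reach) Qx =
    Reach-preserves closed reach (closed x∉S (Reach-source∉ reach) xy Qx)

  ClosedOutside⇒Disconnects : ∀ {Q x y} → ClosedOutside G S Q →
                              x ∉ S → y ∉ S → Q x → ¬ Q y → Disconnects G S
  ClosedOutside⇒Disconnects closed x∉S y∉S Qx ¬Qy =
    _ , _ , x∉S , y∉S , λ reach → ¬Qy (Reach-preserves closed reach Qx)

  small-separator⇒¬KConnected : ∀ {k x y} → x ≢ y → ¬ G x y →
                                Disconnects G S → ∣ S ∣ < k → ¬ KConnected k G
  small-separator⇒¬KConnected x≢y ¬xy _ _ (inj₁ (complete , _)) = ¬xy (complete _ _ x≢y)
  small-separator⇒¬KConnected _ _ disc ∣S∣<k (inj₂ (_ , bound)) = <⇒≱ ∣S∣<k (bound _ disc)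

¬deleteEdge-deleted : ∀ {n} {G : Graph n} {a b} → ¬ deleteEdge G a b a b
¬deleteEdge-deleted (_ , ¬ab) = ¬ab (inj₁ (refl , refl))

module KPathProperties {k n : ℕ} (P : KPath k n) where
  open KPath P

  eᵢ⊆tᵢ : ∀ i → 1 ≤ i → i ≤ p → e i ⊆ t i
  eᵢ⊆tᵢ (suc zero) _ _ = e₁⊆t₁
  eᵢ⊆tᵢ (suc (suc i)) _ i≤p = e⊆t (suc (suc i)) (s≤s (s≤s z≤n)) i≤p

  ∣eᵢ∣≡k : ∀ i → 1 ≤ i → i ≤ p → ∣ e i ∣ ≡ k
  ∣eᵢ∣≡k (suc zero) _ _ = e₁-size
  ∣eᵢ∣≡k (suc (suc i)) _ i≤p = e-size (suc (suc i)) (s≤s (s≤s z≤n)) i≤p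

  eᵢ₋₁⊆tᵢ : ∀ i → 1 ≤ i → i ≤ p → e (i ∸ 1) ⊆ t i
  eᵢ₋₁⊆tᵢ (suc zero) _ _ = e₀⊆t₁
  eᵢ₋₁⊆tᵢ (suc (suc i)) _ i≤p x∈e =
    subst (_ ∈_) (sym (t-step (suc (suc i)) (s≤s (s≤s z≤n)) i≤p)) (x∈p∪q⁺ (inj₁ x∈e))

  ∣eᵢ₋₁∣≡k : ∀ i → 1 ≤ i → i ≤ p → ∣ e (i ∸ 1) ∣ ≡ k
  ∣eᵢ₋₁∣≡k (suc zero) _ _ = e₀-size
  ∣eᵢ₋₁∣≡k (suc (suc i)) _ i≤p = ∣eᵢ∣≡k (suc i) (s≤s z≤n) (≤-trans (n≤1+n _) i≤p)

  eᵢ≢eᵢ₋₁ : ∀ i → 1 ≤ i → i ≤ p → e i ≢ e (i ∸ 1)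
  eᵢ≢eᵢ₋₁ (suc zero) _ _ e₁≡e₀ = e₀≢e₁ (sym e₁≡e₀)
  eᵢ≢eᵢ₋₁ (suc (suc i)) _ i≤p = e-new (suc (suc i)) (s≤s (s≤s z≤n)) i≤p

  ∣tᵢ∣≤1+k : ∀ i → 1 ≤ i → i ≤ p → ∣ t i ∣ ≤ suc k
  ∣tᵢ∣≤1+k (suc zero) _ _ = ≤-reflexive t₁-size
  ∣tᵢ∣≤1+k (suc (suc i)) 1≤i i≤p
    rewrite t-step (suc (suc i)) (s≤s (s≤s z≤n)) i≤p =
      ≤-trans (∣p∪q∣≤∣p∣+∣q∣ (e (suc i)) ⁅ u (suc (suc i)) ⁆)
        (≤-reflexive (trans (cong₂ _+_ (∣eᵢ₋₁∣≡k (suc (suc i)) 1≤i i≤p) (∣⁅x⁆∣≡1 (u (suc (suc i)))))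
                            (+-comm k 1)))

  ∈tᵢ⇒∈eᵢ₋₁⊎≡uᵢ : ∀ i → 2 ≤ i → i ≤ p → ∀ {x} → x ∈ t i → x ∈ e (i ∸ 1) ⊎ x ≡ u i
  ∈tᵢ⇒∈eᵢ₋₁⊎≡uᵢ i 2≤i i≤p {x} x∈tᵢ =
    [ inj₁ , (λ x∈⁅uᵢ⁆ → inj₂ (x∈⁅y⁆⇒x≡y _ x∈⁅uᵢ⁆)) ]′
      (x∈p∪q⁻ (e (i ∸ 1)) ⁅ u i ⁆ (subst (x ∈_) (t-step i 2≤i i≤p) x∈tᵢ))

  ∈tᵢ∧∉eᵢ₋₁⇒≡uᵢ : ∀ i → 2 ≤ i → i ≤ p → ∀ {x} → x ∈ t i → x ∉ e (i ∸ 1) → x ≡ u i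
  ∈tᵢ∧∉eᵢ₋₁⇒≡uᵢ i 2≤i i≤p x∈tᵢ x∉eᵢ₋₁ =
    [ (λ x∈eᵢ₋₁ → contradiction x∈eᵢ₋₁ x∉eᵢ₋₁) , (λ x≡uᵢ → x≡uᵢ) ]′ (∈tᵢ⇒∈eᵢ₋₁⊎≡uᵢ i 2≤i i≤p x∈tᵢ)

  k-subset≡tᵢ-x : ∀ i → 1 ≤ i → i ≤ p → ∀ {E x} → E ⊆ t i → ∣ E ∣ ≡ k →
                  x ∈ t i → x ∉ E → E ≡ t i - x
  k-subset≡tᵢ-x i 1≤i i≤p E⊆tᵢ ∣E∣≡k x∈tᵢ x∉E =
    p⊆q-x∧∣q∣≤1+∣p∣⇒p≡q-x x∈tᵢ (x∉p∧p⊆q⇒p⊆q-x x∉E E⊆tᵢ)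
      (subst (λ m → ∣ t i ∣ ≤ suc m) (sym ∣E∣≡k) (∣tᵢ∣≤1+k i 1≤i i≤p))

  e-later : ∀ {r} j → 1 ≤ r → r ≤ j → j ≤ p → ∀ {x} → x ∈ e j →
            x ∈ e r ⊎ ∃ λ m → r < m × m ≤ j × x ≡ u m
  e-later j 1≤r r≤j j≤p x∈eⱼ with m≤n⇒m<n∨m≡n r≤j
  e-later j 1≤r r≤j j≤p x∈eⱼ | inj₂ refl = inj₁ x∈eⱼ
  e-later (suc j) 1≤r _ j<p x∈eⱼ | inj₁ (s≤s r≤j)
    with ∈tᵢ⇒∈eᵢ₋₁⊎≡uᵢ (suc j) (s≤s (≤-trans 1≤r r≤j)) j<p
           (e⊆t (suc j) (s≤s (≤-trans 1≤r r≤j)) j<p x∈eⱼ)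
  ... | inj₂ x≡u = inj₂ (suc j , s≤s r≤j , ≤-refl , x≡u)
  ... | inj₁ x∈eⱼ₋₁ with e-later j 1≤r r≤j (≤-trans (n≤1+n j) j<p) x∈eⱼ₋₁
  ... | inj₁ x∈eᵣ = inj₁ x∈eᵣ
  ... | inj₂ (m , r<m , m≤j , x≡uₘ) = inj₂ (m , r<m , m≤n⇒m≤1+n m≤j , x≡uₘ)

  -- Step 1 introduces the vertices of t₁, step i ≥ 2 introduces u i.
  IntroducedBefore : ℕ → Fin n → Set
  IntroducedBefore r x = (2 ≤ r × x ∈ t 1) ⊎ ∃ λ i → 2 ≤ i × i < r × x ≡ u i

  IntroducedBefore⇒2≤ : ∀ {r x} → IntroducedBefore r x → 2 ≤ r
  IntroducedBefore⇒2≤ (inj₁ (2≤r , _)) = 2≤r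
  IntroducedBefore⇒2≤ (inj₂ (_ , 2≤i , i<r , _)) = ≤-trans 2≤i (≤-trans (n≤1+n _) i<r)

  IntroducedBefore-mono : ∀ {r s x} → r ≤ s → IntroducedBefore r x → IntroducedBefore s x
  IntroducedBefore-mono r≤s (inj₁ (2≤r , x∈t₁)) = inj₁ (≤-trans 2≤r r≤s , x∈t₁)
  IntroducedBefore-mono r≤s (inj₂ (i , 2≤i , i<r , x≡uᵢ)) = inj₂ (i , 2≤i , <-≤-trans i<r r≤s , x≡uᵢ)

  u-¬IntroducedBefore : ∀ {r} i → 2 ≤ i → i ≤ p → r ≤ i → ¬ IntroducedBefore r (u i)
  u-¬IntroducedBefore i 2≤i i≤p _ (inj₁ (_ , uᵢ∈t₁)) = u-new₁ i 2≤i i≤p uᵢ∈t₁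
  u-¬IntroducedBefore i 2≤i i≤p r≤i (inj₂ (j , 2≤j , j<r , uᵢ≡uⱼ)) =
    u-new i j 2≤j (<-≤-trans j<r r≤i) i≤p uᵢ≡uⱼ

  tᵢ⊆IntroducedBefore : ∀ i → 1 ≤ i → i ≤ p → ∀ {x} → x ∈ t i → IntroducedBefore (suc i) x
  tᵢ⊆IntroducedBefore (suc zero) _ _ x∈t₁ = inj₁ (≤-refl , x∈t₁)
  tᵢ⊆IntroducedBefore (suc (suc i)) _ i≤p x∈tᵢ =
    [ (λ x∈eᵢ₋₁ → IntroducedBefore-mono (n≤1+n _)
                    (tᵢ⊆IntroducedBefore (suc i) (s≤s z≤n) i-1≤p (eᵢ⊆tᵢ (suc i) (s≤s z≤n) i-1≤p x∈eᵢ₋₁)))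
    , (λ x≡uᵢ → inj₂ (suc (suc i) , s≤s (s≤s z≤n) , ≤-refl , x≡uᵢ)) ]′
      (∈tᵢ⇒∈eᵢ₋₁⊎≡uᵢ (suc (suc i)) (s≤s (s≤s z≤n)) i≤p x∈tᵢ)
    where i-1≤p = ≤-trans (n≤1+n _) i≤p

  eᵢ₋₁⊆IntroducedBefore : ∀ i → 2 ≤ i → i ≤ p → ∀ {x} → x ∈ e (i ∸ 1) → IntroducedBefore i x
  eᵢ₋₁⊆IntroducedBefore (suc zero) (s≤s ()) _ _
  eᵢ₋₁⊆IntroducedBefore (suc (suc i)) _ i≤p x∈eᵢ₋₁ =
    let i-1≤p = ≤-trans (n≤1+n _) i≤p in
    tᵢ⊆IntroducedBefore (suc i) (s≤s z≤n) i-1≤p (eᵢ⊆tᵢ (suc i) (s≤s z≤n) i-1≤p x∈eᵢ₋₁)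

module Separator {k n : ℕ} (P : KPath k n) (r : ℕ) (1≤r : 1 ≤ r) (r≤p : r ≤ KPath.p P)
                 (a b : Fin n) (a∈tᵣ : a ∈ KPath.t P r) (a∉eᵣ : a ∉ KPath.e P r)
                 (b∈tᵣ : b ∈ KPath.t P r) (b∉eᵣ₋₁ : b ∉ KPath.e P (r ∸ 1)) where
  open KPath P
  open KPathProperties P

  G′ : Graph n
  G′ = deleteEdge (kpathGraph P) a b

  eᵣ≡tᵣ-a : e r ≡ t r - a
  eᵣ≡tᵣ-a = k-subset≡tᵢ-x r 1≤r r≤p (eᵢ⊆tᵢ r 1≤r r≤p) (∣eᵢ∣≡k r 1≤r r≤p) a∈tᵣ a∉eᵣ

  eᵣ₋₁≡tᵣ-b : e (r ∸ 1) ≡ t r - b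
  eᵣ₋₁≡tᵣ-b = k-subset≡tᵢ-x r 1≤r r≤p (eᵢ₋₁⊆tᵢ r 1≤r r≤p) (∣eᵢ₋₁∣≡k r 1≤r r≤p) b∈tᵣ b∉eᵣ₋₁

  a≢b : a ≢ b
  a≢b refl = eᵢ≢eᵢ₋₁ r 1≤r r≤p (trans eᵣ≡tᵣ-a (sym eᵣ₋₁≡tᵣ-b))

  a∈eᵣ₋₁ : a ∈ e (r ∸ 1)
  a∈eᵣ₋₁ = subst (a ∈_) (sym eᵣ₋₁≡tᵣ-b) (x∈p∧x≢y⇒x∈p-y a∈tᵣ a≢b)

  S : Subset n
  S = t r - a - b

  ∣S∣<k : ∣ S ∣ < k
  ∣S∣<k = ≤-trans (x∈p⇒∣p-x∣<∣p∣ (x∈p∧x≢y⇒x∈p-y b∈tᵣ (λ b≡a → a≢b (sym b≡a))))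
                  (≤-pred (≤-trans (x∈p⇒∣p-x∣<∣p∣ a∈tᵣ) (∣tᵢ∣≤1+k r 1≤r r≤p)))

  a∉S : a ∉ S
  a∉S a∈S = x∉p-x (t r) (p─q⊆p (t r - a) ⁅ b ⁆ a∈S)

  b∉S : b ∉ S
  b∉S = x∉p-x (t r - a)

  ∈tᵣ∖S⇒a⊎b : ∀ {y} → y ∈ t r → y ∉ S → y ≡ a ⊎ y ≡ b
  ∈tᵣ∖S⇒a⊎b {y} y∈tᵣ y∉S with y ≟ᶠ a | y ≟ᶠ b
  ... | yes y≡a | _ = inj₁ y≡a
  ... | no _ | yes y≡b = inj₂ y≡b
  ... | no y≢a | no y≢b = contradiction (x∈p∧x≢y⇒x∈p-y (x∈p∧x≢y⇒x∈p-y y∈tᵣ y≢a) y≢b) y∉S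

  ∈eᵣ₋₁∖S⇒≡a : ∀ {y} → y ∈ e (r ∸ 1) → y ∉ S → y ≡ a
  ∈eᵣ₋₁∖S⇒≡a y∈eᵣ₋₁ y∉S with ∈tᵣ∖S⇒a⊎b (eᵢ₋₁⊆tᵢ r 1≤r r≤p y∈eᵣ₋₁) y∉S
  ... | inj₁ y≡a = y≡a
  ... | inj₂ refl = contradiction y∈eᵣ₋₁ b∉eᵣ₋₁

  ∈eᵣ∖S⇒≡b : ∀ {y} → y ∈ e r → y ∉ S → y ≡ b
  ∈eᵣ∖S⇒≡b y∈eᵣ y∉S with ∈tᵣ∖S⇒a⊎b (eᵢ⊆tᵢ r 1≤r r≤p y∈eᵣ) y∉S
  ... | inj₁ refl = contradiction y∈eᵣ a∉eᵣ
  ... | inj₂ y≡b = y≡b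

  r≱2⇒r≡1 : ¬ 2 ≤ r → r ≡ 1
  r≱2⇒r≡1 r≱2 = ≤-antisym (≤-pred (≰⇒> r≱2)) 1≤r

  Side : Fin n → Set
  Side x = x ≡ a ⊎ IntroducedBefore r x

  Side-u⇒< : ∀ i → 2 ≤ i → i ≤ p → Side (u i) → i < r
  Side-u⇒< i 2≤i i≤p side with suc i ≤? r
  ... | yes i<r = i<r
  ... | no i≮r = ⊥-elim (¬side side)
    where
    r≤i : r ≤ i
    r≤i = ≤-pred (≰⇒> i≮r)
    ¬side : ¬ Side (u i)
    ¬side (inj₂ before) = u-¬IntroducedBefore i 2≤i i≤p r≤i before
    ¬side (inj₁ uᵢ≡a) with 2 ≤? r
    ... | yes 2≤r = u-¬IntroducedBefore i 2≤i i≤p r≤i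
                      (subst (IntroducedBefore r) (sym uᵢ≡a) (eᵢ₋₁⊆IntroducedBefore r 2≤r r≤p a∈eᵣ₋₁))
    ... | no r≱2 =
      u-new₁ i 2≤i i≤p (subst (_∈ t 1) (sym uᵢ≡a) (subst (λ j → a ∈ t j) (r≱2⇒r≡1 r≱2) a∈tᵣ))

  ¬Side-b : ¬ Side b
  ¬Side-b side with 2 ≤? r
  ... | yes 2≤r =
    <-irrefl refl (Side-u⇒< r 2≤r r≤p (subst Side (∈tᵢ∧∉eᵢ₋₁⇒≡uᵢ r 2≤r r≤p b∈tᵣ b∉eᵣ₋₁) side))
  ... | no r≱2 = [ (λ b≡a → a≢b (sym b≡a)) , (λ before → r≱2 (IntroducedBefore⇒2≤ before)) ]′ side

  Side-closed-t₁ : ∀ {x y} → x ≢ y → ¬ ((x ≡ a × y ≡ b) ⊎ (x ≡ b × y ≡ a)) →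
                   y ∈ t 1 → y ∉ S → Side x → Side y
  Side-closed-t₁ x≢y ¬ab y∈t₁ y∉S side with 2 ≤? r
  ... | yes 2≤r = inj₂ (inj₁ (2≤r , y∈t₁))
  ... | no r≱2 with side | ∈tᵣ∖S⇒a⊎b (subst (λ j → _ ∈ t j) (sym (r≱2⇒r≡1 r≱2)) y∈t₁) y∉S
  ...   | inj₂ before | _ = contradiction (IntroducedBefore⇒2≤ before) r≱2
  ...   | inj₁ x≡a | inj₁ y≡a = contradiction (trans x≡a (sym y≡a)) x≢y
  ...   | inj₁ x≡a | inj₂ y≡b = contradiction (inj₁ (x≡a , y≡b)) ¬ab

  Side-closed : ClosedOutside G′ S Side
  Side-closed _ y∉S ((x≢y , inj₁ (_ , y∈t₁)) , ¬ab) side = Side-closed-t₁ x≢y ¬ab y∈t₁ y∉S side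
  Side-closed _ _ ((_ , inj₂ (i , 2≤i , i≤p , inj₁ (x≡uᵢ , y∈eᵢ₋₁))) , _) side =
    inj₂ (IntroducedBefore-mono (≤-trans (n≤1+n i) (Side-u⇒< i 2≤i i≤p (subst Side x≡uᵢ side)))
                                (eᵢ₋₁⊆IntroducedBefore i 2≤i i≤p y∈eᵢ₋₁))
  Side-closed x∉S _ ((_ , inj₂ (i , 2≤i , i≤p , inj₂ (y≡uᵢ , x∈eᵢ₋₁))) , ¬ab) side with <-cmp i r
  ... | tri< i<r _ _ = inj₂ (inj₂ (i , 2≤i , i<r , y≡uᵢ))
  ... | tri≈ _ refl _ =
    contradiction (inj₁ (∈eᵣ₋₁∖S⇒≡a x∈eᵢ₋₁ x∉S ,
                         trans y≡uᵢ (sym (∈tᵢ∧∉eᵢ₋₁⇒≡uᵢ r 2≤i r≤p b∈tᵣ b∉eᵣ₋₁)))) ¬ab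
  ... | tri> _ _ (s≤s r≤i-1) with e-later _ 1≤r r≤i-1 (≤-trans (n≤1+n _) i≤p) x∈eᵢ₋₁
  ...   | inj₁ x∈eᵣ = contradiction (subst Side (∈eᵣ∖S⇒≡b x∈eᵣ x∉S) side) ¬Side-b
  ...   | inj₂ (m , r<m , m≤i-1 , x≡uₘ) =
    ⊥-elim (<-asym r<m (Side-u⇒< m (≤-trans (s≤s 1≤r) r<m) (≤-trans m≤i-1 (≤-trans (n≤1+n _) i≤p))
                                  (subst Side x≡uₘ side)))

mainTheorem4 : (k n : ℕ) → 1 ≤ k → (P : KPath k n) →
    (r : ℕ) → 1 ≤ r → r ≤ KPath.p P →
    (a b : Fin n) →
    a ∈ KPath.t P r → a ∉ KPath.e P r →
    b ∈ KPath.t P r → b ∉ KPath.e P (r ∸ 1) →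
    ¬ KConnected k (deleteEdge (kpathGraph P) a b)
mainTheorem4 k n _ P r 1≤r r≤p a b a∈tᵣ a∉eᵣ b∈tᵣ b∉eᵣ₋₁ =
  small-separator⇒¬KConnected a≢b (¬deleteEdge-deleted {G = kpathGraph P})
    (ClosedOutside⇒Disconnects Side-closed a∉S b∉S (inj₁ refl) ¬Side-b) ∣S∣<k
  where open Separator P r 1≤r r≤p a b a∈tᵣ a∉eᵣ b∈tᵣ b∉eᵣ₋₁
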